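{- For positive integers $n$ and $1\le k\le n$, let $B(n,k)$ be the bipartite graph with vertex set $\{x\subseteq[n]:|x|\in\{k-1,k\}\}$ in which $x,y$ are adjacent iff $x\subsetneq y$, and let $\mathrm{mis}(B(n,k))$ be its number of maximal independent sets. If $k\le\log(n/\log^3 n)$, then as $n\to\infty$, \[ \mathrm{mis}(B(n,k))=(1+o(1))\,2^{\binom{n}{k-1}}. \]
   Context: $\log$ denotes $\log_2$. -}

module Defs where

open import Data.Nat using (ℕ; zero; suc; _+_; _*_; _∸_; _^_; _≤_; _<_)
import Data.Nat as ℕ
open import Data.Bool using (Bool)
import Data.Bool as Bool
open import Data.Fin using (Fin)
open import Data.Fin.Subset using (Subset; inside; outside; ∣_∣; _∈_; _⊆_; _⊂_)
open import Data.Fin.Subset.Properties using (_∈?_; _⊆?_; _⊂?_)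
open import Data.Fin.Properties using (all?)
open import Data.List using (List; []; _∷_; _++_; map; filter; length; lookup)
open import Data.Vec using (_∷_; [])
import Data.Vec.Properties as VecP
open import Data.Sum using (_⊎_)
open import Data.Product using (_×_; _,_)
open import Relation.Nullary using (Dec; yes; no; ¬_)
open import Relation.Nullary.Decidable using (_⊎-dec_; _×-dec_; _→-dec_; ¬?; map′)
open import Relation.Binary.PropositionalEquality using (_≡_)

allSubsets : (n : ℕ) → List (Subset n)
allSubsets zero    = [] ∷ []
allSubsets (suc n) = map (inside ∷_) (allSubsets n) ++ map (outside ∷_) (allSubsets n)

allSubsets? : ∀ {n} {P : Subset n → Set} → (∀ p → Dec (P p)) → Dec (∀ p → P p)
allSubsets? {zero}  {P} P? with P? []
... | yes h = yes λ { [] → h }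
... | no ¬h = no λ f → ¬h (f [])
allSubsets? {suc n} {P} P? with allSubsets? (λ p → P? (inside ∷ p)) | allSubsets? (λ p → P? (outside ∷ p))
... | yes h₁ | yes h₂ = yes λ { (inside ∷ p) → h₁ p ; (outside ∷ p) → h₂ p }
... | no ¬h | _      = no λ f → ¬h (λ p → f (inside ∷ p))
... | yes _ | no ¬h  = no λ f → ¬h (λ p → f (outside ∷ p))

-- The graph B(n,k): vertices are the subsets x ⊆ [n] with |x| ∈ {k-1, k}
-- (here k ∸ 1 = k - 1 since k ≥ 1 in the statement); x,y adjacent iff
-- x ⊊ y or y ⊊ x.

isLevel : (n k : ℕ) (x : Subset n) → Dec ((∣ x ∣ ≡ k ∸ 1) ⊎ (∣ x ∣ ≡ k))
isLevel n k x = (∣ x ∣ ℕ.≟ k ∸ 1) ⊎-dec (∣ x ∣ ℕ.≟ k)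

Bverts : (n k : ℕ) → List (Subset n)
Bverts n k = filter (isLevel n k) (allSubsets n)

Bsize : (n k : ℕ) → ℕ
Bsize n k = length (Bverts n k)

vertex : (n k : ℕ) → Fin (Bsize n k) → Subset n
vertex n k = lookup (Bverts n k)

Adj : (n k : ℕ) → Fin (Bsize n k) → Fin (Bsize n k) → Set
Adj n k u v = (vertex n k u ⊂ vertex n k v) ⊎ (vertex n k v ⊂ vertex n k u)

Independent : (n k : ℕ) → Subset (Bsize n k) → Set
Independent n k I = ∀ u v → u ∈ I → v ∈ I → ¬ Adj n k u v

MaximalIndependent : (n k : ℕ) → Subset (Bsize n k) → Set
MaximalIndependent n k I =
  Independent n k I × (∀ J → Independent n k J → I ⊆ J → J ≡ I)

Adj? : (n k : ℕ) → ∀ u v → Dec (Adj n k u v)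
Adj? n k u v = (vertex n k u ⊂? vertex n k v) ⊎-dec (vertex n k v ⊂? vertex n k u)

Independent? : (n k : ℕ) → ∀ I → Dec (Independent n k I)
Independent? n k I =
  all? λ u → all? λ v → (u ∈? I) →-dec (v ∈? I) →-dec ¬? (Adj? n k u v)

MaximalIndependent? : (n k : ℕ) → ∀ I → Dec (MaximalIndependent n k I)
MaximalIndependent? n k I =
  Independent? n k I ×-dec
  allSubsets? (λ J → Independent? n k J →-dec (I ⊆? J) →-dec VecP.≡-dec Bool._≟_ J I)

mis : (n k : ℕ) → ℕ
mis n k = length (filter (MaximalIndependent? n k) (allSubsets (Bsize n k)))

-- The hypothesis  k ≤ log₂ (n / (log₂ n)³)  for n ≥ 2, without reals.
-- With L = log₂ n > 0 it is equivalent to  L ≤ c := (n / 2^k)^(1/3),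
-- i.e. to  L ≤ a/b  for every rational a/b > c (a, b ∈ ℕ, b > 0),
-- i.e. (a/b)³ > n/2^k  ⇒  n^b ≤ 2^a.
LogBound : (n k : ℕ) → Set
LogBound n k = ∀ a b → 0 < b → n * b ^ 3 < 2 ^ k * a ^ 3 → n ^ b ≤ 2 ^ a

-- A maximal independent set of the bipartite graph B(n, k) is determined by its trace S on the
-- side α of (k-1)-sets, so mis(B(n, k)) ≤ 2 ^ ∣α∣ = 2 ^ (n choose k-1). Conversely every S ⊆ α extends
-- to the maximal independent set S ∪ {w ∉ α : w has no neighbour in S}, unless some a ∈ α ∖ S is
-- undominated: every neighbour of a has a neighbour in S. If a = A, this forces S to meet, for each of
-- the n - k + 1 points i ∉ A, the k - 1 other (k-1)-subsets of A ∪ {i}. These families are disjoint,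
-- so a uniformly random S does so with probability at most (1 - 2 ^ (1-k)) ^ (n-k+1), and
-- 2 ^ ∣α∣ ≤ mis + ε 2 ^ ∣α∣ with ε = (n choose k-1) (1 - 2 ^ (1-k)) ^ (n-k+1). The hypothesis
-- k ≤ log (n / log³ n) makes ε ≤ 1/d for large n.
--
-- Probabilities are counts: an event is a predicate f : Subset N → Bool, and independence of events
-- determined by disjoint sets of coordinates reads count (f ∧ g) * 2 ^ N ≡ count f * count g.

module Submission where

open import Defs
open import Data.Bool using (Bool; true; false; _∧_; _∨_; not; T; if_then_else_)
open import Data.Bool.Properties using (∧-assoc; ∧-zeroʳ; not-involutive; T-∧; T-∨; T-≡)
open import Data.Empty using (⊥; ⊥-elim)
open import Data.Fin using (Fin; zero; suc)
import Data.Fin.Properties as Fin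
open import Data.Fin.Subset
  using (Subset; inside; outside; _∈_; _∉_; _⊆_; _⊂_; _∩_; _∪_; _-_; ⁅_⁆; ∁; ∣_∣)
open import Data.Fin.Subset.Properties
  using (_∈?_; _⊂?_; drop-there; x∉p⇒x∈∁p; x∈∁p⇒x∉p; x∈p⇒x∉∁p; ∣∁p∣≡n∸∣p∣; ∣p∣≤n; p─⊥≡p;
         ∪-identityʳ; ⊆-antisym; p⊂q⇒∣p∣<∣q∣; x∈p∧x≢y⇒x∈p-y; p⊆p∪q; x∈p∪q⁺; x∈p∪q⁻; x∈⁅x⁆;
         x∈⁅y⁆⇒x≡y; x∈p∩q⁺; x∈p∩q⁻; p∩q⊆q)
open import Data.List as List using (List; []; _∷_; _++_; map; filter; length)
open import Data.List.Properties using (length-++; filter-++)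
open import Data.List.Membership.Propositional using () renaming (_∈_ to _∈ˡ_)
open import Data.List.Membership.Propositional.Properties
  using (∈-∃++; ∈-++⁻; ∈-++⁺ˡ; ∈-++⁺ʳ; ∈-map⁺; ∈-map⁻; ∈-filter⁺; ∈-filter⁻; ∈-lookup)
open import Data.List.Relation.Unary.All as All using ([])
open import Data.List.Relation.Unary.AllPairs using ([]; _∷_)
open import Data.List.Relation.Unary.Any using (here; there; index)
open import Data.List.Relation.Unary.Any.Properties using (lookup-index)
open import Data.List.Relation.Unary.Unique.Propositional using (Unique)
import Data.List.Relation.Unary.Unique.Propositional.Properties as Unique
open import Data.Nat using (ℕ; zero; suc; _+_; _*_; _∸_; _^_; _≤_; _<_; z≤n; s≤s; _≤?_; >-nonZero)
open import Data.Nat.Combinatorics using (_C_; nCk+nC[k+1]≡[n+1]C[k+1])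
open import Data.Nat.Properties
open import Algebra.Properties.CommutativeSemigroup +-commutativeSemigroup using (interchange)
open import Data.Nat.Tactic.RingSolver using (solve-∀)
open import Data.Product using (_×_; _,_; proj₁; proj₂; ∃; ∃-syntax)
open import Data.Sum using (_⊎_; inj₁; inj₂; [_,_]′)
open import Data.Unit using (tt)
open import Data.Vec using ([]; _∷_; lookup; tabulate; here; there)
open import Data.Vec.Properties
  using (∷-injectiveʳ; map-∘; map-cong; map-id; lookup∘tabulate; []=⇒lookup; lookup⇒[]=)
open import Function using (id; _∘_; _∘₂_; Equivalence)
open import Level using (0ℓ)
open import Relation.Binary.PropositionalEquality
open import Relation.Nullary using (¬_; Dec; does; yes; no)
open import Relation.Nullary.Decidable using (_×-dec_; _⊎-dec_; _→-dec_; ¬?; decidable-stable; T?)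
open import Relation.Unary using (Pred; Decidable)

-- Counting subsets

count : ∀ {N} → (Subset N → Bool) → ℕ
count {zero}  f = if f [] then 1 else 0
count {suc N} f = count (f ∘ (inside ∷_)) + count (f ∘ (outside ∷_))

count-cong : ∀ {N} {f g : Subset N → Bool} → (∀ x → f x ≡ g x) → count f ≡ count g
count-cong {zero}  e rewrite e [] = refl
count-cong {suc N} e = cong₂ _+_ (count-cong (e ∘ (inside ∷_))) (count-cong (e ∘ (outside ∷_)))

count-mono : ∀ {N} {f g : Subset N → Bool} → (∀ x → T (f x) → T (g x)) → count f ≤ count g
count-mono {zero} {f} {g} f⇒g with f [] | g [] | f⇒g []
... | false | _     | _  = z≤n
... | true  | true  | _  = ≤-refl
... | true  | false | ff = ⊥-elim (ff tt)
count-mono {suc N} f⇒g = +-mono-≤ (count-mono (f⇒g ∘ (inside ∷_))) (count-mono (f⇒g ∘ (outside ∷_)))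

count-split : ∀ {N} (f g : Subset N → Bool) →
  count f ≡ count (λ x → f x ∧ g x) + count (λ x → f x ∧ not (g x))
count-split {zero} f g with f [] | g []
... | false | _     = refl
... | true  | true  = refl
... | true  | false = refl
count-split {suc N} f g =
  trans (cong₂ _+_ (count-split (f ∘ (inside ∷_)) (g ∘ (inside ∷_)))
                   (count-split (f ∘ (outside ∷_)) (g ∘ (outside ∷_))))
        (interchange (part inside g) (part inside (not ∘ g)) (part outside g) (part outside (not ∘ g)))
  where
  part : _ → (Subset (suc N) → Bool) → ℕ
  part b h = count (λ x → f (b ∷ x) ∧ h (b ∷ x))

count-∨ : ∀ {N} (f g : Subset N → Bool) → count (λ x → f x ∨ g x) ≤ count f + count g
count-∨ {zero} f g with f [] | g []
... | false | false = z≤n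
... | false | true  = ≤-refl
... | true  | _     = s≤s z≤n
count-∨ {suc N} f g =
  ≤-trans (+-mono-≤ (count-∨ (f ∘ (inside ∷_)) (g ∘ (inside ∷_)))
                    (count-∨ (f ∘ (outside ∷_)) (g ∘ (outside ∷_))))
          (≤-reflexive (interchange (count (f ∘ (inside ∷_))) (count (g ∘ (inside ∷_)))
                                    (count (f ∘ (outside ∷_))) (count (g ∘ (outside ∷_)))))

2^-double : ∀ e → 2 ^ e + 2 ^ e ≡ 2 ^ suc e
2^-double e = cong (2 ^ e +_) (sym (+-identityʳ (2 ^ e)))

count-true : ∀ N → count {N} (λ _ → true) ≡ 2 ^ N
count-true zero    = refl
count-true (suc N) = trans (cong (λ c → c + c) (count-true N)) (2^-double N)

count-false : ∀ N → count {N} (λ _ → false) ≡ 0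
count-false zero    = refl
count-false (suc N) = cong₂ _+_ (count-false N) (count-false N)

meets : ∀ {N} → Subset N → Subset N → Bool
meets []      []      = false
meets (a ∷ x) (b ∷ y) = (a ∧ b) ∨ meets x y

meets⇒∃ : ∀ {N} (x F : Subset N) → T (meets x F) → ∃ λ u → u ∈ x × u ∈ F
meets⇒∃ []            []            ()
meets⇒∃ (inside  ∷ x) (inside  ∷ F) _ = zero , here , here
meets⇒∃ (inside  ∷ x) (outside ∷ F) t with meets⇒∃ x F t
... | u , u∈x , u∈F = suc u , there u∈x , there u∈F
meets⇒∃ (outside ∷ x) (_       ∷ F) t with meets⇒∃ x F t
... | u , u∈x , u∈F = suc u , there u∈x , there u∈F

∈∩∈⇒meets : ∀ {N} (x F : Subset N) {u} → u ∈ x → u ∈ F → T (meets x F)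
∈∩∈⇒meets (inside ∷ x) (inside ∷ F) here here = tt
∈∩∈⇒meets (a ∷ x) (b ∷ F) (there u∈x) (there u∈F) with a ∧ b
... | true  = tt
... | false = ∈∩∈⇒meets x F u∈x u∈F

count-disjoint : ∀ {N} (F : Subset N) → count (λ x → not (meets x F)) ≡ 2 ^ ∣ ∁ F ∣
count-disjoint []            = refl
count-disjoint {suc N} (inside ∷ F) = trans (cong (_+ count (λ x → not (meets x F))) (count-false N)) (count-disjoint F)
count-disjoint (outside ∷ F) = trans (cong (λ c → c + c) (count-disjoint F)) (2^-double ∣ ∁ F ∣)

∁-involutive : ∀ {N} (a : Subset N) → ∁ (∁ a) ≡ a
∁-involutive a = trans (sym (map-∘ not not a)) (trans (map-cong not-involutive a) (map-id a))

DependsOn : ∀ {N} → Subset N → (Subset N → Bool) → Set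
DependsOn F f = ∀ x y → (∀ {u} → u ∈ F → lookup x u ≡ lookup y u) → f x ≡ f y

dependsOn-⊆ : ∀ {N} {F G : Subset N} {f} → F ⊆ G → DependsOn F f → DependsOn G f
dependsOn-⊆ F⊆G dep x y agree = dep x y (agree ∘ F⊆G)

meets-dependsOn : ∀ {N} (F : Subset N) → DependsOn F (λ x → meets x F)
meets-dependsOn []            []      []      _     = refl
meets-dependsOn (inside  ∷ F) (a ∷ x) (b ∷ y) agree rewrite agree here =
  cong (b ∧ true ∨_) (meets-dependsOn F x y (agree ∘ there))
meets-dependsOn (outside ∷ F) (a ∷ x) (b ∷ y) agree =
  cong₂ _∨_ (trans (∧-zeroʳ a) (sym (∧-zeroʳ b))) (meets-dependsOn F x y (agree ∘ there))

dependsOn-tail : ∀ {N} {b c} {F : Subset N} {f} → DependsOn (c ∷ F) f → DependsOn F (f ∘ (b ∷_))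
dependsOn-tail dep x y agree = dep _ _ λ { here → refl ; (there u∈F) → agree u∈F }

count-independent : ∀ {N} (F : Subset N) (f g : Subset N → Bool) → DependsOn F f → DependsOn (∁ F) g →
  count (λ x → f x ∧ g x) * 2 ^ N ≡ count f * count g
count-independent {zero} [] f g _ _ with f [] | g []
... | true  | true  = refl
... | true  | false = refl
... | false | _     = refl
count-independent {suc N} (inside ∷ F) f g df dg = begin
  (count (λ x → f₁ x ∧ g₁ x) + count (λ x → f₀ x ∧ g₀ x)) * 2 ^ suc N
    ≡⟨ cong (λ c → (count (λ x → f₁ x ∧ g₁ x) + c) * 2 ^ suc N)
            (count-cong (λ x → cong (f₀ x ∧_) (sym (g₁≗g₀ x)))) ⟩
  (count (λ x → f₁ x ∧ g₁ x) + count (λ x → f₀ x ∧ g₁ x)) * (2 * 2 ^ N)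
    ≡⟨ distrib (count (λ x → f₁ x ∧ g₁ x)) (count (λ x → f₀ x ∧ g₁ x)) (2 ^ N) ⟩
  2 * (count (λ x → f₁ x ∧ g₁ x) * 2 ^ N + count (λ x → f₀ x ∧ g₁ x) * 2 ^ N)
    ≡⟨ cong (2 *_) (cong₂ _+_ (count-independent F f₁ g₁ (dependsOn-tail df) (dependsOn-tail dg))
                              (count-independent F f₀ g₁ (dependsOn-tail df) (dependsOn-tail dg))) ⟩
  2 * (count f₁ * count g₁ + count f₀ * count g₁)
    ≡⟨ regroupʳ (count f₁) (count f₀) (count g₁) ⟩
  (count f₁ + count f₀) * (count g₁ + count g₁)
    ≡⟨ cong (λ c → (count f₁ + count f₀) * (count g₁ + c)) (count-cong g₁≗g₀) ⟩
  (count f₁ + count f₀) * (count g₁ + count g₀) ∎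
  where
  open ≡-Reasoning
  f₁ = f ∘ (inside ∷_)
  f₀ = f ∘ (outside ∷_)
  g₁ = g ∘ (inside ∷_)
  g₀ = g ∘ (outside ∷_)
  g₁≗g₀ : ∀ x → g₁ x ≡ g₀ x
  g₁≗g₀ x = dg (inside ∷ x) (outside ∷ x) λ { (there _) → refl }
  distrib : ∀ a b p → (a + b) * (2 * p) ≡ 2 * (a * p + b * p)
  distrib = solve-∀
  regroupʳ : ∀ a b c → 2 * (a * c + b * c) ≡ (a + b) * (c + c)
  regroupʳ = solve-∀
count-independent {suc N} (outside ∷ F) f g df dg = begin
  (count (λ x → f₁ x ∧ g₁ x) + count (λ x → f₀ x ∧ g₀ x)) * 2 ^ suc N
    ≡⟨ cong (λ c → (count (λ x → f₁ x ∧ g₁ x) + c) * 2 ^ suc N)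
            (count-cong (λ x → cong (_∧ g₀ x) (sym (f₁≗f₀ x)))) ⟩
  (count (λ x → f₁ x ∧ g₁ x) + count (λ x → f₁ x ∧ g₀ x)) * (2 * 2 ^ N)
    ≡⟨ distrib (count (λ x → f₁ x ∧ g₁ x)) (count (λ x → f₁ x ∧ g₀ x)) (2 ^ N) ⟩
  2 * (count (λ x → f₁ x ∧ g₁ x) * 2 ^ N + count (λ x → f₁ x ∧ g₀ x) * 2 ^ N)
    ≡⟨ cong (2 *_) (cong₂ _+_ (count-independent F f₁ g₁ (dependsOn-tail df) (dependsOn-tail dg))
                              (count-independent F f₁ g₀ (dependsOn-tail df) (dependsOn-tail dg))) ⟩
  2 * (count f₁ * count g₁ + count f₁ * count g₀)
    ≡⟨ regroupˡ (count f₁) (count g₁) (count g₀) ⟩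
  (count f₁ + count f₁) * (count g₁ + count g₀)
    ≡⟨ cong (λ c → (count f₁ + c) * (count g₁ + count g₀)) (count-cong f₁≗f₀) ⟩
  (count f₁ + count f₀) * (count g₁ + count g₀) ∎
  where
  open ≡-Reasoning
  f₁ = f ∘ (inside ∷_)
  f₀ = f ∘ (outside ∷_)
  g₁ = g ∘ (inside ∷_)
  g₀ = g ∘ (outside ∷_)
  f₁≗f₀ : ∀ x → f₁ x ≡ f₀ x
  f₁≗f₀ x = df (inside ∷ x) (outside ∷ x) λ { (there _) → refl }
  distrib : ∀ a b p → (a + b) * (2 * p) ≡ 2 * (a * p + b * p)
  distrib = solve-∀
  regroupˡ : ∀ a b c → 2 * (a * b + a * c) ≡ (a + a) * (b + c)
  regroupˡ = solve-∀

allOf : ∀ {r N} → Subset r → (Fin r → Subset N → Bool) → Subset N → Bool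
allOf []             Q x = true
allOf (inside  ∷ is) Q x = Q zero x ∧ allOf is (Q ∘ suc) x
allOf (outside ∷ is) Q x = allOf is (Q ∘ suc) x

allOf-dependsOn : ∀ {r N} (is : Subset r) (Q : Fin r → Subset N → Bool) {G : Subset N} →
  (∀ i → DependsOn G (Q i)) → DependsOn G (allOf is Q)
allOf-dependsOn []             Q dep x y agree = refl
allOf-dependsOn (inside  ∷ is) Q dep x y agree =
  cong₂ _∧_ (dep zero x y agree) (allOf-dependsOn is (Q ∘ suc) (dep ∘ suc) x y agree)
allOf-dependsOn (outside ∷ is) Q dep x y agree = allOf-dependsOn is (Q ∘ suc) (dep ∘ suc) x y agree

allOf-intro : ∀ {r N} (is : Subset r) (Q : Fin r → Subset N → Bool) x →
  (∀ i → i ∈ is → T (Q i x)) → T (allOf is Q x)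
allOf-intro []             Q x h = tt
allOf-intro (inside  ∷ is) Q x h =
  Equivalence.from T-∧ (h zero here , allOf-intro is (Q ∘ suc) x (λ i → h (suc i) ∘ there))
allOf-intro (outside ∷ is) Q x h = allOf-intro is (Q ∘ suc) x (λ i → h (suc i) ∘ there)

∧-dependsOn : ∀ {N} {F : Subset N} {f g} → DependsOn F f → DependsOn F g → DependsOn F (λ x → f x ∧ g x)
∧-dependsOn df dg x y agree = cong₂ _∧_ (df x y agree) (dg x y agree)

count-allOf : ∀ {r N} E W (is : Subset r) (Q : Fin r → Subset N → Bool) (F : Fin r → Subset N)
  (g : Subset N → Bool) (G : Subset N) →
  (∀ i → DependsOn (F i) (Q i)) → (∀ {i j u} → u ∈ F i → u ∈ F j → i ≡ j) →
  DependsOn G g → (∀ {i u} → u ∈ F i → u ∉ G) →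
  (∀ i → i ∈ is → count (Q i) * E ≤ 2 ^ N * W) →
  count (λ x → allOf is Q x ∧ g x) * E ^ ∣ is ∣ ≤ count g * W ^ ∣ is ∣
count-allOf E W [] Q F g G _ _ _ _ _ = ≤-refl
count-allOf E W (outside ∷ is) Q F g G dep disjoint dg F∉G bound =
  count-allOf E W is (Q ∘ suc) (F ∘ suc) g G (dep ∘ suc) (Fin.suc-injective ∘₂ disjoint) dg F∉G
    (λ i → bound (suc i) ∘ there)
count-allOf {N = N} E W (inside ∷ is) Q F g G dep disjoint dg F∉G bound = begin
  count (λ x → (Q zero x ∧ rest x) ∧ g x) * E ^ suc ∣ is ∣
    ≡⟨ cong (_* E ^ suc ∣ is ∣) (count-cong (λ x → ∧-assoc (Q zero x) (rest x) (g x))) ⟩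
  c * (E * E ^ ∣ is ∣)
    ≤⟨ *-cancelʳ-≤ _ _ P {{m^n≢0 2 N}} (begin
      c * (E * E ^ ∣ is ∣) * P       ≡⟨ lemma₁ c E (E ^ ∣ is ∣) P ⟩
      c * P * (E * E ^ ∣ is ∣)       ≡⟨ cong (_* (E * E ^ ∣ is ∣)) independent ⟩
      a * b * (E * E ^ ∣ is ∣)       ≡⟨ lemma₂ a b E (E ^ ∣ is ∣) ⟩
      (a * E) * (b * E ^ ∣ is ∣)     ≤⟨ *-mono-≤ (bound zero here) ih ⟩
      (P * W) * (count g * W ^ ∣ is ∣) ≡⟨ lemma₃ P W (count g) (W ^ ∣ is ∣) ⟩
      count g * (W * W ^ ∣ is ∣) * P ∎) ⟩
  count g * W ^ suc ∣ is ∣ ∎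
  where
  open ≤-Reasoning
  P = 2 ^ N
  rest = allOf is (Q ∘ suc)
  c = count (λ x → Q zero x ∧ (rest x ∧ g x))
  a = count (Q zero)
  b = count (λ x → rest x ∧ g x)
  rest∧g-dependsOn : DependsOn (∁ (F zero)) (λ x → rest x ∧ g x)
  rest∧g-dependsOn = ∧-dependsOn
    (allOf-dependsOn is (Q ∘ suc) λ j →
      dependsOn-⊆ (λ u∈Fj → x∉p⇒x∈∁p λ u∈F₀ → Fin.0≢1+n (disjoint u∈F₀ u∈Fj)) (dep (suc j)))
    (dependsOn-⊆ (λ u∈G → x∉p⇒x∈∁p λ u∈F₀ → F∉G u∈F₀ u∈G) dg)
  independent : c * P ≡ a * b
  independent = count-independent (F zero) (Q zero) (λ x → rest x ∧ g x) (dep zero) rest∧g-dependsOn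
  ih : b * E ^ ∣ is ∣ ≤ count g * W ^ ∣ is ∣
  ih = count-allOf E W is (Q ∘ suc) (F ∘ suc) g G (dep ∘ suc) (Fin.suc-injective ∘₂ disjoint) dg F∉G
         (λ i → bound (suc i) ∘ there)
  lemma₁ : ∀ c e f p → c * (e * f) * p ≡ c * p * (e * f)
  lemma₁ = solve-∀
  lemma₂ : ∀ a b e f → a * b * (e * f) ≡ (a * e) * (b * f)
  lemma₂ = solve-∀
  lemma₃ : ∀ p w c v → (p * w) * (c * v) ≡ c * (w * v) * p
  lemma₃ = solve-∀

count-meets : ∀ {N} K (F : Subset N) → ∣ F ∣ ≤ K → count (λ x → meets x F) * 2 ^ K ≤ 2 ^ N * (2 ^ K ∸ 1)
count-meets {N} K F ∣F∣≤K = begin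
  m * 2 ^ K                            ≡⟨ m+n∸n≡m (m * 2 ^ K) (d * 2 ^ K) ⟨
  (m * 2 ^ K + d * 2 ^ K) ∸ d * 2 ^ K  ≡⟨ cong (_∸ d * 2 ^ K) (*-distribʳ-+ (2 ^ K) m d) ⟨
  (m + d) * 2 ^ K ∸ d * 2 ^ K          ≡⟨ cong (λ c → c * 2 ^ K ∸ d * 2 ^ K) m+d≡2^N ⟩
  2 ^ N * 2 ^ K ∸ d * 2 ^ K            ≤⟨ ∸-monoʳ-≤ (2 ^ N * 2 ^ K) 2^N≤d*2^K ⟩
  2 ^ N * 2 ^ K ∸ 2 ^ N * 1            ≡⟨ *-distribˡ-∸ (2 ^ N) (2 ^ K) 1 ⟨
  2 ^ N * (2 ^ K ∸ 1)                  ∎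
  where
  open ≤-Reasoning
  m = count (λ x → meets x F)
  d = count (λ x → not (meets x F))
  m+d≡2^N : m + d ≡ 2 ^ N
  m+d≡2^N = trans (sym (count-split (λ _ → true) (λ x → meets x F))) (count-true N)
  2^N≤d*2^K : 2 ^ N * 1 ≤ d * 2 ^ K
  2^N≤d*2^K = begin
    2 ^ N * 1                 ≡⟨ *-identityʳ (2 ^ N) ⟩
    2 ^ N                     ≡⟨ cong (2 ^_) (trans (cong (_+ ∣ F ∣) (∣∁p∣≡n∸∣p∣ F)) (m∸n+n≡m (∣p∣≤n F))) ⟨
    2 ^ (∣ ∁ F ∣ + ∣ F ∣)     ≡⟨ ^-distribˡ-+-* 2 ∣ ∁ F ∣ ∣ F ∣ ⟩
    2 ^ ∣ ∁ F ∣ * 2 ^ ∣ F ∣   ≤⟨ *-monoʳ-≤ (2 ^ ∣ ∁ F ∣) (^-monoʳ-≤ 2 ∣F∣≤K) ⟩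
    2 ^ ∣ ∁ F ∣ * 2 ^ K       ≡⟨ cong (_* 2 ^ K) (count-disjoint F) ⟨
    d * 2 ^ K                 ∎

T-not⇒¬T : ∀ {b} → T (not b) → ¬ T b
T-not⇒¬T {true} ()

¬T⇒T-not : ∀ {b} → ¬ T b → T (not b)
¬T⇒T-not {true}  ¬t = ¬t tt
¬T⇒T-not {false} _  = tt

_⊆ᵇ_ : ∀ {N} → Subset N → Subset N → Bool
x ⊆ᵇ a = not (meets x (∁ a))

count-⊆ᵇ : ∀ {N} (a : Subset N) → count (_⊆ᵇ a) ≡ 2 ^ ∣ a ∣
count-⊆ᵇ a = trans (count-disjoint (∁ a)) (cong (λ c → 2 ^ ∣ c ∣) (∁-involutive a))

⊆ᵇ-dependsOn : ∀ {N} (a : Subset N) → DependsOn (∁ a) (_⊆ᵇ a)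
⊆ᵇ-dependsOn a x y agree = cong not (meets-dependsOn (∁ a) x y agree)

⊆ᵇ⇒⊆ : ∀ {N} {x a : Subset N} → T (x ⊆ᵇ a) → x ⊆ a
⊆ᵇ⇒⊆ {x = x} {a} t {u} u∈x with u ∈? a
... | yes u∈a = u∈a
... | no  u∉a = ⊥-elim (T-not⇒¬T t (∈∩∈⇒meets x (∁ a) u∈x (x∉p⇒x∈∁p u∉a)))

⊆⇒⊆ᵇ : ∀ {N} {x a : Subset N} → x ⊆ a → T (x ⊆ᵇ a)
⊆⇒⊆ᵇ {x = x} {a} x⊆a = ¬T⇒T-not λ t →
  let (u , u∈x , u∈∁a) = meets⇒∃ x (∁ a) t in x∈∁p⇒x∉p u∈∁a (x⊆a u∈x)

anyOf : ∀ {V N} → (Fin V → Subset N → Bool) → Subset N → Bool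
anyOf {zero}  h x = false
anyOf {suc V} h x = h zero x ∨ anyOf (h ∘ suc) x

anyOf-intro : ∀ {V N} (h : Fin V → Subset N → Bool) {x} a → T (h a x) → T (anyOf h x)
anyOf-intro h zero    t = Equivalence.from T-∨ (inj₁ t)
anyOf-intro h (suc a) t = Equivalence.from T-∨ (inj₂ (anyOf-intro (h ∘ suc) a t))

count-anyOf : ∀ {V N} (α : Subset V) (h : Fin V → Subset N → Bool) E X →
  (∀ a → a ∈ α → count (h a) * E ≤ X) → (∀ a → a ∉ α → ∀ x → ¬ T (h a x)) →
  count (anyOf h) * E ≤ ∣ α ∣ * X
count-anyOf {N = N} [] h E X _ _ = ≤-reflexive (cong (_* E) (count-false N))
count-anyOf (inside ∷ α) h E X bound empty = begin
  count (anyOf h) * E                                   ≤⟨ *-monoˡ-≤ E (count-∨ (h zero) (anyOf (h ∘ suc))) ⟩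
  (count (h zero) + count (anyOf (h ∘ suc))) * E        ≡⟨ *-distribʳ-+ E (count (h zero)) _ ⟩
  count (h zero) * E + count (anyOf (h ∘ suc)) * E      ≤⟨ +-mono-≤ (bound zero here) ih ⟩
  X + ∣ α ∣ * X                                         ∎
  where
  open ≤-Reasoning
  ih : count (anyOf (h ∘ suc)) * E ≤ ∣ α ∣ * X
  ih = count-anyOf α (h ∘ suc) E X (λ a → bound (suc a) ∘ there) (λ a a∉α → empty (suc a) (a∉α ∘ drop-there))
count-anyOf (outside ∷ α) h E X bound empty =
  ≤-trans (*-monoˡ-≤ E (count-mono λ x t →
             [ (λ t₀ → ⊥-elim (empty zero (λ ()) x t₀)) , id ]′ (Equivalence.to T-∨ t)))
          (count-anyOf α (h ∘ suc) E X (λ a → bound (suc a) ∘ there) (λ a a∉α → empty (suc a) (a∉α ∘ drop-there)))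

count-∣∣≡ : ∀ m j → count {m} (λ x → does (∣ x ∣ ≟ j)) ≡ m C j
count-∣∣≡ zero    zero    = refl
count-∣∣≡ zero    (suc j) = refl
count-∣∣≡ (suc m) zero    =
  trans (cong (_+ count {m} (λ x → does (∣ x ∣ ≟ 0))) (count-false m)) (count-∣∣≡ m zero)
count-∣∣≡ (suc m) (suc j) =
  trans (cong₂ _+_ (count-∣∣≡ m j) (count-∣∣≡ m (suc j))) (nCk+nC[k+1]≡[n+1]C[k+1] m j)

does-sound : ∀ {A : Set} (a? : Dec A) → T (does a?) → A
does-sound (yes a) _ = a

does-complete : ∀ {A : Set} (a? : Dec A) → A → T (does a?)
does-complete (yes _)  _ = tt
does-complete (no  ¬a) a = ¬a a

subsetOf : ∀ {N} {P : Fin N → Set} → (∀ u → Dec (P u)) → Subset N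
subsetOf P? = tabulate (does ∘ P?)

module _ {N} {P : Fin N → Set} (P? : ∀ u → Dec (P u)) where

  ∈-subsetOf⁻ : ∀ {u} → u ∈ subsetOf P? → P u
  ∈-subsetOf⁻ {u} u∈ = does-sound (P? u)
    (Equivalence.from T-≡ (trans (sym (lookup∘tabulate (does ∘ P?) u)) ([]=⇒lookup u∈)))

  ∈-subsetOf⁺ : ∀ {u} → P u → u ∈ subsetOf P?
  ∈-subsetOf⁺ {u} pu = lookup⇒[]= u (subsetOf P?)
    (trans (lookup∘tabulate (does ∘ P?) u) (Equivalence.to T-≡ (does-complete (P? u) pu)))

x∈p⇒suc∣p-x∣≡∣p∣ : ∀ {n} (p : Subset n) {x} → x ∈ p → suc ∣ p - x ∣ ≡ ∣ p ∣
x∈p⇒suc∣p-x∣≡∣p∣ (inside  ∷ p) here        = cong (suc ∘ ∣_∣) (p─⊥≡p p)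
x∈p⇒suc∣p-x∣≡∣p∣ (inside  ∷ p) (there x∈p) = cong suc (x∈p⇒suc∣p-x∣≡∣p∣ p x∈p)
x∈p⇒suc∣p-x∣≡∣p∣ (outside ∷ p) (there x∈p) = x∈p⇒suc∣p-x∣≡∣p∣ p x∈p

x∉p⇒∣p∪⁅x⁆∣≡suc∣p∣ : ∀ {n} (p : Subset n) x → x ∉ p → ∣ p ∪ ⁅ x ⁆ ∣ ≡ suc ∣ p ∣
x∉p⇒∣p∪⁅x⁆∣≡suc∣p∣ (inside  ∷ p) zero    x∉p = ⊥-elim (x∉p here)
x∉p⇒∣p∪⁅x⁆∣≡suc∣p∣ (outside ∷ p) zero    _   = cong (suc ∘ ∣_∣) (∪-identityʳ p)
x∉p⇒∣p∪⁅x⁆∣≡suc∣p∣ (inside  ∷ p) (suc x) x∉p = cong suc (x∉p⇒∣p∪⁅x⁆∣≡suc∣p∣ p x (x∉p ∘ there))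
x∉p⇒∣p∪⁅x⁆∣≡suc∣p∣ (outside ∷ p) (suc x) x∉p = x∉p⇒∣p∪⁅x⁆∣≡suc∣p∣ p x (x∉p ∘ there)

p⊆q∧∣q∣≤∣p∣⇒p≡q : ∀ {n} {p q : Subset n} → p ⊆ q → ∣ q ∣ ≤ ∣ p ∣ → p ≡ q
p⊆q∧∣q∣≤∣p∣⇒p≡q {p = p} p⊆q ∣q∣≤∣p∣ = ⊆-antisym p⊆q q⊆p
  where
  q⊆p : _ ⊆ p
  q⊆p {x} x∈q with x ∈? p
  ... | yes x∈p = x∈p
  ... | no  x∉p = ⊥-elim (<⇒≱ (p⊂q⇒∣p∣<∣q∣ (p⊆q , x , x∈q , x∉p)) ∣q∣≤∣p∣)

injection⇒∣p∣≤∣q∣ : ∀ {m n} (p : Subset m) (q : Subset n) (g : ∀ {x} → x ∈ p → Fin n) →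
  (∀ {x} (x∈p : x ∈ p) → g x∈p ∈ q) →
  (∀ {x y} (x∈p : x ∈ p) (y∈p : y ∈ p) → g x∈p ≡ g y∈p → x ≡ y) →
  ∣ p ∣ ≤ ∣ q ∣
injection⇒∣p∣≤∣q∣ []            q g g∈q g-inj = z≤n
injection⇒∣p∣≤∣q∣ (outside ∷ p) q g g∈q g-inj =
  injection⇒∣p∣≤∣q∣ p q (g ∘ there) (g∈q ∘ there)
    (λ x∈p y∈p → Fin.suc-injective ∘ g-inj (there x∈p) (there y∈p))
injection⇒∣p∣≤∣q∣ (inside ∷ p) q g g∈q g-inj =
  subst (suc ∣ p ∣ ≤_) (x∈p⇒suc∣p-x∣≡∣p∣ q (g∈q here)) (s≤s (injection⇒∣p∣≤∣q∣ p (q - g here) (g ∘ there)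
    (λ x∈p → x∈p∧x≢y⇒x∈p-y (g∈q (there x∈p)) (λ e → Fin.0≢1+n (g-inj here (there x∈p) (sym e))))
    (λ x∈p y∈p → Fin.suc-injective ∘ g-inj (there x∈p) (there y∈p))))

p⊆q∪⁅x⁆∧x∉p⇒p⊆q : ∀ {n} {p q : Subset n} {x} → p ⊆ q ∪ ⁅ x ⁆ → x ∉ p → p ⊆ q
p⊆q∪⁅x⁆∧x∉p⇒p⊆q {q = q} {x} p⊆q∪x x∉p {y} y∈p with x∈p∪q⁻ q ⁅ x ⁆ (p⊆q∪x y∈p)
... | inj₁ y∈q = y∈q
... | inj₂ y∈x = ⊥-elim (x∉p (subst (_∈ _) (x∈⁅y⁆⇒x≡y x y∈x) y∈p))

p⊆q∪⁅x⁆∧p⊆q∪⁅y⁆∧x≢y⇒p⊆q : ∀ {n} {p q : Subset n} {x y} →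
  p ⊆ q ∪ ⁅ x ⁆ → p ⊆ q ∪ ⁅ y ⁆ → x ≢ y → p ⊆ q
p⊆q∪⁅x⁆∧p⊆q∪⁅y⁆∧x≢y⇒p⊆q {q = q} {x} {y} p⊆q∪x p⊆q∪y x≢y {z} z∈p
  with x∈p∪q⁻ q ⁅ x ⁆ (p⊆q∪x z∈p) | x∈p∪q⁻ q ⁅ y ⁆ (p⊆q∪y z∈p)
... | inj₁ z∈q | _        = z∈q
... | inj₂ _   | inj₁ z∈q = z∈q
... | inj₂ z∈x | inj₂ z∈y = ⊥-elim (x≢y (trans (sym (x∈⁅y⁆⇒x≡y x z∈x)) (x∈⁅y⁆⇒x≡y y z∈y)))

length-≤-injection : ∀ {A B : Set} (xs : List A) (ys : List B) (φ : A → B) → Unique xs →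
  (∀ {x} → x ∈ˡ xs → φ x ∈ˡ ys) → (∀ {x y} → x ∈ˡ xs → y ∈ˡ xs → φ x ≡ φ y → x ≡ y) →
  length xs ≤ length ys
length-≤-injection []       ys φ _          _     _   = z≤n
length-≤-injection (x ∷ xs) ys φ (x∉xs ∷ u) φ∈ys φ-inj with ∈-∃++ (φ∈ys (here refl))
... | us , vs , refl = subst (suc (length xs) ≤_) length-us++φx∷vs
        (s≤s (length-≤-injection xs (us ++ vs) φ u φ∈us++vs (λ p q → φ-inj (there p) (there q))))
  where
  length-us++φx∷vs : suc (length (us ++ vs)) ≡ length (us ++ φ x ∷ vs)
  length-us++φx∷vs = trans (cong suc (length-++ us)) (trans (sym (+-suc (length us) (length vs))) (sym (length-++ us)))
  φ∈us++vs : ∀ {y} → y ∈ˡ xs → φ y ∈ˡ us ++ vs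
  φ∈us++vs {y} y∈xs with ∈-++⁻ us (φ∈ys (there y∈xs))
  ... | inj₁ p         = ∈-++⁺ˡ p
  ... | inj₂ (here e)  = ⊥-elim (All.lookup x∉xs y∈xs (sym (φ-inj (there y∈xs) (here refl) e)))
  ... | inj₂ (there p) = ∈-++⁺ʳ us p

allSubsets-complete : ∀ {N} (x : Subset N) → x ∈ˡ allSubsets N
allSubsets-complete []                    = here refl
allSubsets-complete {suc N} (inside  ∷ x) = ∈-++⁺ˡ (∈-map⁺ (inside ∷_) (allSubsets-complete x))
allSubsets-complete {suc N} (outside ∷ x) =
  ∈-++⁺ʳ (map (inside ∷_) (allSubsets N)) (∈-map⁺ (outside ∷_) (allSubsets-complete x))

allSubsets-unique : ∀ N → Unique (allSubsets N)
allSubsets-unique zero    = [] ∷ []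
allSubsets-unique (suc N) =
  Unique.++⁺ (Unique.map⁺ ∷-injectiveʳ (allSubsets-unique N)) (Unique.map⁺ ∷-injectiveʳ (allSubsets-unique N)) disjoint
  where
  disjoint : ∀ {v} → ¬ (v ∈ˡ map (inside ∷_) (allSubsets N) × v ∈ˡ map (outside ∷_) (allSubsets N))
  disjoint (p , q) with ∈-map⁻ (inside ∷_) p | ∈-map⁻ (outside ∷_) q
  ... | _ , _ , refl | _ , _ , ()

length-filter-map : ∀ {A B : Set} {P : Pred B 0ℓ} (P? : Decidable P) (g : A → B) xs →
  length (filter P? (map g xs)) ≡ length (filter (P? ∘ g) xs)
length-filter-map P? g []       = refl
length-filter-map P? g (x ∷ xs) with does (P? (g x))
... | true  = cong suc (length-filter-map P? g xs)
... | false = length-filter-map P? g xs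

length-filter-allSubsets : ∀ {N} {P : Pred (Subset N) 0ℓ} (P? : Decidable P) →
  length (filter P? (allSubsets N)) ≡ count (does ∘ P?)
length-filter-allSubsets {zero}  P? with does (P? [])
... | true  = refl
... | false = refl
length-filter-allSubsets {suc N} P? = begin
  length (filter P? (map (inside ∷_) (allSubsets N) ++ map (outside ∷_) (allSubsets N)))
    ≡⟨ cong length (filter-++ P? (map (inside ∷_) (allSubsets N)) _) ⟩
  length (filter P? (map (inside ∷_) (allSubsets N)) ++ filter P? (map (outside ∷_) (allSubsets N)))
    ≡⟨ length-++ (filter P? (map (inside ∷_) (allSubsets N))) ⟩
  length (filter P? (map (inside ∷_) (allSubsets N))) + length (filter P? (map (outside ∷_) (allSubsets N)))
    ≡⟨ cong₂ _+_ (trans (length-filter-map P? (inside ∷_) (allSubsets N)) (length-filter-allSubsets (P? ∘ (inside ∷_))))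
                 (trans (length-filter-map P? (outside ∷_) (allSubsets N)) (length-filter-allSubsets (P? ∘ (outside ∷_)))) ⟩
  count (does ∘ P?) ∎
  where open ≡-Reasoning

count-≤-injection : ∀ {N} (f g : Subset N → Bool) (φ : Subset N → Subset N) →
  (∀ {x} → T (f x) → T (g (φ x))) → (∀ {x y} → T (f x) → T (f y) → φ x ≡ φ y → x ≡ y) →
  count f ≤ count g
count-≤-injection {N} f g φ f⇒gφ φ-inj =
  subst₂ _≤_ (length-filter-allSubsets (T? ∘ f)) (length-filter-allSubsets (T? ∘ g))
    (length-≤-injection (filter (T? ∘ f) (allSubsets N)) (filter (T? ∘ g) (allSubsets N)) φ
      (Unique.filter⁺ (T? ∘ f) (allSubsets-unique N))
      (λ x∈ → ∈-filter⁺ (T? ∘ g) (allSubsets-complete _) (f⇒gφ (fx x∈)))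
      (λ x∈ y∈ → φ-inj (fx x∈) (fx y∈)))
  where
  fx : ∀ {x} → x ∈ˡ filter (T? ∘ f) (allSubsets N) → T (f x)
  fx x∈ = proj₂ (∈-filter⁻ (T? ∘ f) {xs = allSubsets N} x∈)

lookup-injective : ∀ {A : Set} {xs : List A} → Unique xs → ∀ i j → List.lookup xs i ≡ List.lookup xs j → i ≡ j
lookup-injective (_     ∷ _) zero    zero    _ = refl
lookup-injective (x∉xs ∷ _) zero    (suc j) e = ⊥-elim (All.lookup x∉xs (∈-lookup j) e)
lookup-injective (x∉xs ∷ _) (suc i) zero    e = ⊥-elim (All.lookup x∉xs (∈-lookup i) (sym e))
lookup-injective (_     ∷ u) (suc i) (suc j) e = cong suc (lookup-injective u i j e)

filter-filter-⇒ : ∀ {A : Set} {P Q : Pred A 0ℓ} (P? : Decidable P) (Q? : Decidable Q) →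
  (∀ {x} → P x → Q x) → ∀ xs → filter P? (filter Q? xs) ≡ filter P? xs
filter-filter-⇒ P? Q? P⇒Q []       = refl
filter-filter-⇒ P? Q? P⇒Q (x ∷ xs) with Q? x
... | yes _ with P? x
...   | yes _ = cong (x ∷_) (filter-filter-⇒ P? Q? P⇒Q xs)
...   | no  _ = filter-filter-⇒ P? Q? P⇒Q xs
filter-filter-⇒ P? Q? P⇒Q (x ∷ xs) | no ¬qx with P? x
...   | yes px = ⊥-elim (¬qx (P⇒Q px))
...   | no  _  = filter-filter-⇒ P? Q? P⇒Q xs

∣subsetOf-lookup∣ : ∀ {A : Set} {P : Pred A 0ℓ} (P? : Decidable P) (xs : List A) →
  ∣ subsetOf (P? ∘ List.lookup xs) ∣ ≡ length (filter P? xs)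
∣subsetOf-lookup∣ P? []       = refl
∣subsetOf-lookup∣ P? (x ∷ xs) with does (P? x)
... | true  = cong suc (∣subsetOf-lookup∣ P? xs)
... | false = ∣subsetOf-lookup∣ P? xs

-- Maximal independent sets of bipartite graphs

module BipartiteGraph {V : ℕ} (Adj : Fin V → Fin V → Set) (Adj? : ∀ u v → Dec (Adj u v))
  (Adj-sym : ∀ {u v} → Adj u v → Adj v u) (α : Subset V)
  (no-edge-inside-α : ∀ {u v} → Adj u v → u ∈ α → v ∈ α → ⊥)
  (no-edge-outside-α : ∀ {u v} → Adj u v → u ∉ α → v ∉ α → ⊥) where

  IsIndependent : Subset V → Set
  IsIndependent I = ∀ u v → u ∈ I → v ∈ I → ¬ Adj u v

  IsMaximalIndependent : Subset V → Set
  IsMaximalIndependent I = IsIndependent I × (∀ J → IsIndependent J → I ⊆ J → J ≡ I)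

  -- Outside α, a maximal independent set consists of the vertices with no neighbour in it,
  -- and all their neighbours lie in α.
  maximal-∩α-⊆ : ∀ {I J} → IsMaximalIndependent I → IsMaximalIndependent J → I ∩ α ≡ J ∩ α → I ⊆ J
  maximal-∩α-⊆ {I} {J} (I-indep , _) (J-indep , J-max) I∩α≡J∩α {v} v∈I with v ∈? α | v ∈? J
  ... | yes v∈α | _       = proj₁ (x∈p∩q⁻ J α (subst (v ∈_) I∩α≡J∩α (x∈p∩q⁺ (v∈I , v∈α))))
  ... | no  _   | yes v∈J = v∈J
  ... | no  v∉α | no  v∉J =
    ⊥-elim (v∉J (subst (v ∈_) (J-max (J ∪ ⁅ v ⁆) J∪v-indep (p⊆p∪q ⁅ v ⁆)) (x∈p∪q⁺ (inj₂ (x∈⁅x⁆ v)))))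
    where
    v-free : ∀ w → w ∈ J → ¬ Adj v w
    v-free w w∈J v~w with w ∈? α
    ... | yes w∈α =
      I-indep v w v∈I (proj₁ (x∈p∩q⁻ I α (subst (w ∈_) (sym I∩α≡J∩α) (x∈p∩q⁺ (w∈J , w∈α))))) v~w
    ... | no  w∉α = no-edge-outside-α v~w v∉α w∉α
    J∪v-indep : IsIndependent (J ∪ ⁅ v ⁆)
    J∪v-indep u w u∈ w∈ u~w with x∈p∪q⁻ J ⁅ v ⁆ u∈ | x∈p∪q⁻ J ⁅ v ⁆ w∈
    ... | inj₁ u∈J | inj₁ w∈J = J-indep u w u∈J w∈J u~w
    ... | inj₂ u≡v | inj₁ w∈J rewrite x∈⁅y⁆⇒x≡y v u≡v = v-free w w∈J u~w
    ... | inj₁ u∈J | inj₂ w≡v rewrite x∈⁅y⁆⇒x≡y v w≡v = v-free u u∈J (Adj-sym u~w)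
    ... | inj₂ u≡v | inj₂ w≡v rewrite x∈⁅y⁆⇒x≡y v u≡v | x∈⁅y⁆⇒x≡y v w≡v =
      no-edge-outside-α u~w v∉α v∉α

  count-maximal≤2^∣α∣ : (Max? : ∀ I → Dec (IsMaximalIndependent I)) → count (does ∘ Max?) ≤ 2 ^ ∣ α ∣
  count-maximal≤2^∣α∣ Max? = ≤-trans
    (count-≤-injection (does ∘ Max?) (_⊆ᵇ α) (_∩ α) (λ {I} _ → ⊆⇒⊆ᵇ (p∩q⊆q I α))
      (λ I-max J-max e → ⊆-antisym (maximal-∩α-⊆ (does-sound (Max? _) I-max) (does-sound (Max? _) J-max) e)
                                   (maximal-∩α-⊆ (does-sound (Max? _) J-max) (does-sound (Max? _) I-max) (sym e))))
    (≤-reflexive (count-⊆ᵇ α))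

  Free : Subset V → Fin V → Set
  Free S w = w ∉ α × (∀ u → u ∈ S → ¬ Adj u w)

  Free? : ∀ S w → Dec (Free S w)
  Free? S w = ¬? (w ∈? α) ×-dec Fin.all? λ u → (u ∈? S) →-dec ¬? (Adj? u w)

  ∈⊎Free? : ∀ S w → Dec (w ∈ S ⊎ Free S w)
  ∈⊎Free? S w = (w ∈? S) ⊎-dec Free? S w

  extend : Subset V → Subset V
  extend S = subsetOf (∈⊎Free? S)

  ∈-extend⁻ : ∀ {S w} → w ∈ extend S → w ∈ S ⊎ Free S w
  ∈-extend⁻ {S} = ∈-subsetOf⁻ (∈⊎Free? S)

  ∈-extend⁺ : ∀ {S w} → w ∈ S ⊎ Free S w → w ∈ extend S
  ∈-extend⁺ {S} = ∈-subsetOf⁺ (∈⊎Free? S)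

  Undominated : Fin V → Subset V → Set
  Undominated a S = a ∈ α × a ∉ S × (∀ w → Free S w → ¬ Adj a w)

  Undominated? : ∀ a S → Dec (Undominated a S)
  Undominated? a S = (a ∈? α) ×-dec ¬? (a ∈? S) ×-dec Fin.all? λ w → Free? S w →-dec ¬? (Adj? a w)

  extend-independent : ∀ {S} → S ⊆ α → IsIndependent (extend S)
  extend-independent S⊆α u v u∈ v∈ u~v with ∈-extend⁻ u∈ | ∈-extend⁻ v∈
  ... | inj₁ u∈S        | inj₁ v∈S        = no-edge-inside-α u~v (S⊆α u∈S) (S⊆α v∈S)
  ... | inj₁ u∈S        | inj₂ (_ , v-free) = v-free u u∈S u~v
  ... | inj₂ (_ , u-free) | inj₁ v∈S        = u-free v v∈S (Adj-sym u~v)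
  ... | inj₂ (u∉α , _)  | inj₂ (v∉α , _)  = no-edge-outside-α u~v u∉α v∉α

  extend-maximal : ∀ {S} → S ⊆ α → (∀ a → ¬ Undominated a S) → IsMaximalIndependent (extend S)
  extend-maximal {S} S⊆α dominated =
    extend-independent S⊆α , λ J J-indep ext⊆J → ⊆-antisym (J⊆ext J-indep ext⊆J) ext⊆J
    where
    J⊆ext : ∀ {J} → IsIndependent J → extend S ⊆ J → J ⊆ extend S
    J⊆ext {J} J-indep ext⊆J {v} v∈J with v ∈? S | v ∈? α
    ... | yes v∈S | _       = ∈-extend⁺ (inj₁ v∈S)
    ... | no  v∉S | yes v∈α =
      ⊥-elim (dominated v (v∈α , v∉S , λ w w-free → J-indep v w v∈J (ext⊆J (∈-extend⁺ (inj₂ w-free)))))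
    ... | no  _   | no  v∉α =
      ∈-extend⁺ (inj₂ (v∉α , λ u u∈S → J-indep u v (ext⊆J (∈-extend⁺ (inj₁ u∈S))) v∈J))

  extend-∩α : ∀ {S w} → w ∈ extend S → w ∈ α → w ∈ S
  extend-∩α w∈ w∈α with ∈-extend⁻ w∈
  ... | inj₁ w∈S       = w∈S
  ... | inj₂ (w∉α , _) = ⊥-elim (w∉α w∈α)

  undominated : Fin V → Subset V → Bool
  undominated a S = S ⊆ᵇ α ∧ does (Undominated? a S)

  2^∣α∣≤count-maximal+undominated : (Max? : ∀ I → Dec (IsMaximalIndependent I)) →
    2 ^ ∣ α ∣ ≤ count (does ∘ Max?) + count (anyOf undominated)
  2^∣α∣≤count-maximal+undominated Max? = begin
    2 ^ ∣ α ∣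
      ≡⟨ count-⊆ᵇ α ⟨
    count (_⊆ᵇ α)
      ≡⟨ trans (count-split (_⊆ᵇ α) (anyOf undominated)) (+-comm (count bad) (count good)) ⟩
    count good + count bad
      ≤⟨ +-mono-≤ (count-≤-injection good (does ∘ Max?) extend extends-to-maximal extend-injective)
                  (count-mono {f = bad} (λ S → proj₂ ∘ Equivalence.to (T-∧ {S ⊆ᵇ α}))) ⟩
    count (does ∘ Max?) + count (anyOf undominated) ∎
    where
    open ≤-Reasoning
    good bad : Subset V → Bool
    good S = S ⊆ᵇ α ∧ not (anyOf undominated S)
    bad  S = S ⊆ᵇ α ∧ anyOf undominated S
    extends-to-maximal : ∀ {S} → T (good S) → T (does (Max? (extend S)))
    extends-to-maximal {S} t = does-complete (Max? (extend S)) (extend-maximal (⊆ᵇ⇒⊆ S⊆α) λ a a-undom →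
      T-not⇒¬T none (anyOf-intro undominated a
        (Equivalence.from T-∧ (S⊆α , does-complete (Undominated? a S) a-undom))))
      where
      S⊆α = proj₁ (Equivalence.to T-∧ t)
      none = proj₂ (Equivalence.to T-∧ t)
    extend-injective : ∀ {S S'} → T (good S) → T (good S') → extend S ≡ extend S' → S ≡ S'
    extend-injective t t' e = ⊆-antisym
      (λ u∈S  → extend-∩α (subst (_ ∈_) e       (∈-extend⁺ (inj₁ u∈S)))  (⊆ᵇ⇒⊆ (proj₁ (Equivalence.to T-∧ t))  u∈S))
      (λ u∈S' → extend-∩α (subst (_ ∈_) (sym e) (∈-extend⁺ (inj₁ u∈S'))) (⊆ᵇ⇒⊆ (proj₁ (Equivalence.to T-∧ t')) u∈S'))

-- The graph B(n, k)

module LevelGraph (n K : ℕ) where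

  k = suc K
  V = Bsize n k
  vtx = vertex n k

  vertex-injective : ∀ {u v} → vtx u ≡ vtx v → u ≡ v
  vertex-injective = lookup-injective (Unique.filter⁺ (isLevel n k) (allSubsets-unique n)) _ _

  ∣vertex∣ : ∀ u → ∣ vtx u ∣ ≡ K ⊎ ∣ vtx u ∣ ≡ k
  ∣vertex∣ u = proj₂ (∈-filter⁻ (isLevel n k) {xs = allSubsets n} (∈-lookup u))

  vertex-surjective : ∀ x → ∣ x ∣ ≡ k → ∃ λ u → vtx u ≡ x
  vertex-surjective x ∣x∣≡k = index x∈ , sym (lookup-index x∈)
    where x∈ = ∈-filter⁺ (isLevel n k) (allSubsets-complete x) (inj₂ ∣x∣≡k)

  lower : Subset V
  lower = subsetOf (λ u → ∣ vtx u ∣ ≟ K)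

  ∈-lower⁻ : ∀ {u} → u ∈ lower → ∣ vtx u ∣ ≡ K
  ∈-lower⁻ = ∈-subsetOf⁻ (λ u → ∣ vtx u ∣ ≟ K)

  ∈-lower⁺ : ∀ {u} → ∣ vtx u ∣ ≡ K → u ∈ lower
  ∈-lower⁺ = ∈-subsetOf⁺ (λ u → ∣ vtx u ∣ ≟ K)

  ∉-lower⁻ : ∀ {u} → u ∉ lower → ∣ vtx u ∣ ≡ k
  ∉-lower⁻ {u} u∉ with ∣vertex∣ u
  ... | inj₁ ∣u∣≡K = ⊥-elim (u∉ (∈-lower⁺ ∣u∣≡K))
  ... | inj₂ ∣u∣≡k = ∣u∣≡k

  ∉-lower⁺ : ∀ {u} → ∣ vtx u ∣ ≡ k → u ∉ lower
  ∉-lower⁺ ∣u∣≡k u∈ = <-irrefl (trans (sym (∈-lower⁻ u∈)) ∣u∣≡k) (n<1+n K)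

  ∣lower∣ : ∣ lower ∣ ≡ n C K
  ∣lower∣ = begin
    ∣ lower ∣
      ≡⟨ ∣subsetOf-lookup∣ (λ x → ∣ x ∣ ≟ K) (Bverts n k) ⟩
    length (filter (λ x → ∣ x ∣ ≟ K) (filter (isLevel n k) (allSubsets n)))
      ≡⟨ cong length (filter-filter-⇒ _ (isLevel n k) inj₁ (allSubsets n)) ⟩
    length (filter (λ x → ∣ x ∣ ≟ K) (allSubsets n))
      ≡⟨ length-filter-allSubsets {n} (λ x → ∣ x ∣ ≟ K) ⟩
    count {n} (λ x → does (∣ x ∣ ≟ K))
      ≡⟨ count-∣∣≡ n K ⟩
    n C K ∎
    where open ≡-Reasoning

  Adj-sym : ∀ {u v} → Adj n k u v → Adj n k v u
  Adj-sym (inj₁ u⊂v) = inj₂ u⊂v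
  Adj-sym (inj₂ v⊂u) = inj₁ v⊂u

  Adj⇒∣∣≢ : ∀ {u v} → Adj n k u v → ∣ vtx u ∣ ≢ ∣ vtx v ∣
  Adj⇒∣∣≢ (inj₁ u⊂v) e = <-irrefl e (p⊂q⇒∣p∣<∣q∣ u⊂v)
  Adj⇒∣∣≢ (inj₂ v⊂u) e = <-irrefl (sym e) (p⊂q⇒∣p∣<∣q∣ v⊂u)

  lower-upper-⊂ : ∀ {u v} → Adj n k u v → u ∈ lower → v ∉ lower → vtx u ⊂ vtx v
  lower-upper-⊂ (inj₁ u⊂v) _ _ = u⊂v
  lower-upper-⊂ (inj₂ v⊂u) u∈ v∉ =
    ⊥-elim (<-asym (p⊂q⇒∣p∣<∣q∣ v⊂u) (subst₂ _<_ (sym (∈-lower⁻ u∈)) (sym (∉-lower⁻ v∉)) (n<1+n K)))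

  open BipartiteGraph (Adj n k) (Adj? n k) Adj-sym lower
    (λ u~v u∈ v∈ → Adj⇒∣∣≢ u~v (trans (∈-lower⁻ u∈) (sym (∈-lower⁻ v∈))))
    (λ u~v u∉ v∉ → Adj⇒∣∣≢ u~v (trans (∉-lower⁻ u∉) (sym (∉-lower⁻ v∉))))
    public

  mis≡count : mis n k ≡ count (does ∘ MaximalIndependent? n k)
  mis≡count = length-filter-allSubsets (MaximalIndependent? n k)

  module _ (a : Fin V) (a∈lower : a ∈ lower) where

    A : Subset n
    A = vtx a

    InShadow : Fin n → Fin V → Set
    InShadow i u = u ∈ lower × vtx u ⊂ A ∪ ⁅ i ⁆ × u ≢ a

    InShadow? : ∀ i u → Dec (InShadow i u)
    InShadow? i u = (u ∈? lower) ×-dec (vtx u ⊂? (A ∪ ⁅ i ⁆)) ×-dec ¬? (u Fin.≟ a)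

    shadow : Fin n → Subset V
    shadow i = subsetOf (InShadow? i)

    ∈-shadow⁻ : ∀ {i u} → u ∈ shadow i → InShadow i u
    ∈-shadow⁻ {i} = ∈-subsetOf⁻ (InShadow? i)

    ∈-shadow⁺ : ∀ {i u} → InShadow i u → u ∈ shadow i
    ∈-shadow⁺ {i} = ∈-subsetOf⁺ (InShadow? i)

    ⊆A⇒≡a : ∀ {u} → u ∈ lower → vtx u ⊆ A → u ≡ a
    ⊆A⇒≡a u∈ u⊆A =
      vertex-injective (p⊆q∧∣q∣≤∣p∣⇒p≡q u⊆A (≤-reflexive (trans (∈-lower⁻ a∈lower) (sym (∈-lower⁻ u∈)))))

    shadow-disjoint : ∀ {i j u} → u ∈ shadow i → u ∈ shadow j → i ≡ j
    shadow-disjoint {i} {j} u∈i u∈j with i Fin.≟ j | ∈-shadow⁻ u∈i | ∈-shadow⁻ u∈j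
    ... | yes i≡j | _                            | _                  = i≡j
    ... | no  i≢j | u∈ , (u⊆A∪i , _) , u≢a | _ , (u⊆A∪j , _) , _ =
      ⊥-elim (u≢a (⊆A⇒≡a u∈ (p⊆q∪⁅x⁆∧p⊆q∪⁅y⁆∧x≢y⇒p⊆q u⊆A∪i u⊆A∪j i≢j)))

    ∣shadow∣≤K : ∀ {i} → i ∉ A → ∣ shadow i ∣ ≤ K
    ∣shadow∣≤K {i} i∉A = subst (∣ shadow i ∣ ≤_) (∈-lower⁻ a∈lower)
      (injection⇒∣p∣≤∣q∣ (shadow i) A missing missing∈A
        (λ u∈ v∈ e → vertex-injective (trans (vtx≡ u∈) (trans (cong (A ∪ ⁅ i ⁆ -_) e) (sym (vtx≡ v∈))))))
      where
      -- Each member of the shadow is A ∪ ⁅ i ⁆ with one point of A removed, and that point determines it.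
      missing : ∀ {u} → u ∈ shadow i → Fin n
      missing u∈ = proj₁ (proj₂ (proj₁ (proj₂ (∈-shadow⁻ u∈))))
      missing∈A : ∀ {u} (u∈ : u ∈ shadow i) → missing u∈ ∈ A
      missing∈A u∈ with ∈-shadow⁻ u∈
      ... | u∈lower , (u⊆A∪i , j , j∈A∪i , j∉u) , u≢a with x∈p∪q⁻ A ⁅ i ⁆ j∈A∪i
      ...   | inj₁ j∈A = j∈A
      ...   | inj₂ j∈i =
        ⊥-elim (u≢a (⊆A⇒≡a u∈lower (p⊆q∪⁅x⁆∧x∉p⇒p⊆q u⊆A∪i (subst (_∉ _) (x∈⁅y⁆⇒x≡y i j∈i) j∉u))))
      vtx≡ : ∀ {u} (u∈ : u ∈ shadow i) → vtx u ≡ (A ∪ ⁅ i ⁆) - missing u∈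
      vtx≡ u∈ with ∈-shadow⁻ u∈
      ... | u∈lower , (u⊆A∪i , j , j∈A∪i , j∉u) , _ = p⊆q∧∣q∣≤∣p∣⇒p≡q
        (λ y∈u → x∈p∧x≢y⇒x∈p-y (u⊆A∪i y∈u) (λ y≡j → j∉u (subst (_∈ vtx _) y≡j y∈u)))
        (≤-reflexive (suc-injective (begin
          suc ∣ (A ∪ ⁅ i ⁆) - j ∣ ≡⟨ x∈p⇒suc∣p-x∣≡∣p∣ (A ∪ ⁅ i ⁆) j∈A∪i ⟩
          ∣ A ∪ ⁅ i ⁆ ∣          ≡⟨ x∉p⇒∣p∪⁅x⁆∣≡suc∣p∣ A i i∉A ⟩
          suc ∣ A ∣              ≡⟨ cong suc (trans (∈-lower⁻ a∈lower) (sym (∈-lower⁻ u∈lower))) ⟩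
          suc ∣ vtx _ ∣          ∎)))
        where open ≡-Reasoning

    undominated⇒meets-shadow : ∀ {S} → S ⊆ lower → Undominated a S → ∀ i → i ∉ A → T (meets S (shadow i))
    undominated⇒meets-shadow {S} S⊆lower (_ , a∉S , a-undominated) i i∉A =
      decidable-stable (T? (meets S (shadow i))) λ ¬meets → a-undominated w (w-free ¬meets) a~w
      where
      ∣A∪i∣≡k : ∣ A ∪ ⁅ i ⁆ ∣ ≡ k
      ∣A∪i∣≡k = trans (x∉p⇒∣p∪⁅x⁆∣≡suc∣p∣ A i i∉A) (cong suc (∈-lower⁻ a∈lower))
      w : Fin V
      w = proj₁ (vertex-surjective (A ∪ ⁅ i ⁆) ∣A∪i∣≡k)
      vtx-w : vtx w ≡ A ∪ ⁅ i ⁆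
      vtx-w = proj₂ (vertex-surjective (A ∪ ⁅ i ⁆) ∣A∪i∣≡k)
      w∉lower : w ∉ lower
      w∉lower = ∉-lower⁺ (trans (cong ∣_∣ vtx-w) ∣A∪i∣≡k)
      a~w : Adj n k a w
      a~w = inj₁ (subst (A ⊂_) (sym vtx-w) (p⊆p∪q ⁅ i ⁆ , i , x∈p∪q⁺ (inj₂ (x∈⁅x⁆ i)) , i∉A))
      w-free : ¬ T (meets S (shadow i)) → Free S w
      w-free ¬meets = w∉lower , λ u u∈S u~w → ¬meets (∈∩∈⇒meets S (shadow i) u∈S
        (∈-shadow⁺ (S⊆lower u∈S , subst (vtx u ⊂_) vtx-w (lower-upper-⊂ u~w (S⊆lower u∈S) w∉lower)
                   , λ u≡a → a∉S (subst (_∈ S) u≡a u∈S))))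

    -- If a is undominated by S ⊆ lower, then for each i ∉ A the upper vertex A ∪ ⁅ i ⁆ has a
    -- neighbour in S other than a: S meets each of the n - K disjoint shadows, of size at most K.
    count-undominated : count (undominated a) * (2 ^ K) ^ (n ∸ K) ≤ 2 ^ ∣ lower ∣ * (2 ^ K ∸ 1) ^ (n ∸ K)
    count-undominated = begin
      count (undominated a) * (2 ^ K) ^ (n ∸ K)
        ≤⟨ *-monoˡ-≤ _ (count-mono {f = undominated a} undominated⇒all-meet) ⟩
      count all-meet∧⊆lower * (2 ^ K) ^ (n ∸ K)
        ≡⟨ cong (λ m → count all-meet∧⊆lower * (2 ^ K) ^ m) ∣∁A∣≡n∸K ⟨
      count all-meet∧⊆lower * (2 ^ K) ^ ∣ ∁ A ∣
        ≤⟨ count-allOf (2 ^ K) (2 ^ K ∸ 1) (∁ A) meets-shadow shadow (_⊆ᵇ lower) (∁ lower)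
             (meets-dependsOn ∘ shadow) shadow-disjoint (⊆ᵇ-dependsOn lower) (x∈p⇒x∉∁p ∘ proj₁ ∘ ∈-shadow⁻)
             (λ i i∈∁A → count-meets K (shadow i) (∣shadow∣≤K (x∈∁p⇒x∉p i∈∁A))) ⟩
      count (_⊆ᵇ lower) * (2 ^ K ∸ 1) ^ ∣ ∁ A ∣
        ≡⟨ cong₂ (λ c m → c * (2 ^ K ∸ 1) ^ m) (count-⊆ᵇ lower) ∣∁A∣≡n∸K ⟩
      2 ^ ∣ lower ∣ * (2 ^ K ∸ 1) ^ (n ∸ K) ∎
      where
      open ≤-Reasoning
      ∣∁A∣≡n∸K : ∣ ∁ A ∣ ≡ n ∸ K
      ∣∁A∣≡n∸K = trans (∣∁p∣≡n∸∣p∣ A) (cong (n ∸_) (∈-lower⁻ a∈lower))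
      meets-shadow : Fin n → Subset V → Bool
      meets-shadow i S = meets S (shadow i)
      all-meet∧⊆lower : Subset V → Bool
      all-meet∧⊆lower S = allOf (∁ A) meets-shadow S ∧ S ⊆ᵇ lower
      undominated⇒all-meet : ∀ S → T (undominated a S) → T (all-meet∧⊆lower S)
      undominated⇒all-meet S t = let (S⊆lower , a-undominated) = Equivalence.to T-∧ t in
        Equivalence.from T-∧ (allOf-intro (∁ A) meets-shadow S (λ i i∈∁A → undominated⇒meets-shadow
          (⊆ᵇ⇒⊆ S⊆lower) (does-sound (Undominated? a S) a-undominated) i (x∈∁p⇒x∉p i∈∁A)) , S⊆lower)

  mis≤2^nCK : mis n k ≤ 2 ^ (n C K)
  mis≤2^nCK = subst₂ _≤_ (sym mis≡count) (cong (2 ^_) ∣lower∣) (count-maximal≤2^∣α∣ (MaximalIndependent? n k))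

  2^nCK≤mis+undominated : 2 ^ (n C K) ≤ mis n k + count (anyOf undominated)
  2^nCK≤mis+undominated = subst₂ (λ c m → 2 ^ c ≤ m + count (anyOf undominated)) ∣lower∣ (sym mis≡count)
    (2^∣α∣≤count-maximal+undominated (MaximalIndependent? n k))

  d*undominated≤2^nCK : ∀ d → d * (n C K) * (2 ^ K ∸ 1) ^ (n ∸ K) ≤ (2 ^ K) ^ (n ∸ K) →
    d * count (anyOf undominated) ≤ 2 ^ (n C K)
  d*undominated≤2^nCK d analytic = *-cancelʳ-≤ (d * e) R E {{m^n≢0 (2 ^ K) (n ∸ K) {{m^n≢0 2 K}}}} (begin
    d * e * E           ≡⟨ *-assoc d e E ⟩
    d * (e * E)         ≤⟨ *-monoʳ-≤ d (subst (λ c → e * E ≤ c * (2 ^ c * W)) ∣lower∣ count-anyOf-undominated) ⟩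
    d * (nCK * (R * W)) ≡⟨ lemma d nCK R W ⟩
    R * (d * nCK * W)   ≤⟨ *-monoʳ-≤ R analytic ⟩
    R * E               ∎)
    where
    open ≤-Reasoning
    e = count (anyOf undominated)
    nCK = n C K
    R = 2 ^ nCK
    E = (2 ^ K) ^ (n ∸ K)
    W = (2 ^ K ∸ 1) ^ (n ∸ K)
    count-anyOf-undominated : e * E ≤ ∣ lower ∣ * (2 ^ ∣ lower ∣ * W)
    count-anyOf-undominated = count-anyOf lower undominated E (2 ^ ∣ lower ∣ * W) count-undominated
      λ a a∉lower S t → a∉lower (proj₁ (does-sound (Undominated? a S) (proj₂ (Equivalence.to (T-∧ {S ⊆ᵇ lower}) t))))
    lemma : ∀ d c r w → d * (c * (r * w)) ≡ r * (d * c * w)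
    lemma = solve-∀

-- Estimates

n<2^n : ∀ n → n < 2 ^ n
n<2^n zero    = s≤s z≤n
n<2^n (suc n) = begin-strict
  suc n         ≤⟨ n<2^n n ⟩
  2 ^ n         <⟨ m<m+n (2 ^ n) (m^n>0 2 n) ⟩
  2 ^ n + 2 ^ n ≡⟨ 2^-double n ⟩
  2 ^ suc n     ∎
  where open ≤-Reasoning

nCk≤n^k : ∀ n k → n C k ≤ n ^ k
nCk≤n^k n       zero    = ≤-refl
nCk≤n^k zero    (suc k) = z≤n
nCk≤n^k (suc n) (suc k) = begin
  suc n C suc k     ≡⟨ nCk+nC[k+1]≡[n+1]C[k+1] n k ⟨
  n C k + n C suc k ≤⟨ +-mono-≤ (nCk≤n^k n k) (nCk≤n^k n (suc k)) ⟩
  suc n * n ^ k     ≤⟨ *-monoʳ-≤ (suc n) (^-monoˡ-≤ k (n≤1+n n)) ⟩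
  suc n * suc n ^ k ∎
  where open ≤-Reasoning

^-distribʳ-* : ∀ a b t → (a * b) ^ t ≡ a ^ t * b ^ t
^-distribʳ-* a b zero    = refl
^-distribʳ-* a b (suc t) = trans (cong (a * b *_) (^-distribʳ-* a b t)) (lemma a b (a ^ t) (b ^ t))
  where
  lemma : ∀ a b x y → a * b * (x * y) ≡ a * x * (b * y)
  lemma = solve-∀

-- Bernoulli's inequality (1 + 1/x) ^ j ≥ 1 + j/x, cleared of denominators.
bernoulli : ∀ x j → x ^ j * (x + j) ≤ suc x ^ j * x
bernoulli x zero    = ≤-reflexive (+-identityʳ (x + 0))
bernoulli x (suc j) = begin
  x * x ^ j * (x + suc j)   ≡⟨ lemma₁ x (x ^ j) j ⟩
  x ^ j * (x * (x + suc j)) ≤⟨ *-monoʳ-≤ (x ^ j) (≤-trans (m≤m+n (x * (x + suc j)) j) (≤-reflexive (lemma₂ x j))) ⟩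
  x ^ j * (suc x * (x + j)) ≡⟨ lemma₃ (x ^ j) x j ⟩
  suc x * (x ^ j * (x + j)) ≤⟨ *-monoʳ-≤ (suc x) (bernoulli x j) ⟩
  suc x * (suc x ^ j * x)   ≡⟨ *-assoc (suc x) (suc x ^ j) x ⟨
  suc x * suc x ^ j * x     ∎
  where
  open ≤-Reasoning
  lemma₁ : ∀ x y j → x * y * (x + suc j) ≡ y * (x * (x + suc j))
  lemma₁ = solve-∀
  lemma₂ : ∀ x j → x * (x + suc j) + j ≡ suc x * (x + j)
  lemma₂ = solve-∀
  lemma₃ : ∀ y x j → y * (suc x * (x + j)) ≡ suc x * (y * (x + j))
  lemma₃ = solve-∀

2*x^[1+x]≤[1+x]^[1+x] : ∀ x → 2 * x ^ suc x ≤ suc x ^ suc x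
2*x^[1+x]≤[1+x]^[1+x] zero     = z≤n
2*x^[1+x]≤[1+x]^[1+x] x@(suc _) = *-cancelʳ-≤ (2 * x ^ suc x) (suc x ^ suc x) x (begin
  2 * x ^ suc x * x       ≡⟨ lemma (x ^ suc x) x ⟩
  x ^ suc x * (x + x)     ≤⟨ *-monoʳ-≤ (x ^ suc x) (+-monoʳ-≤ x (n≤1+n x)) ⟩
  x ^ suc x * (x + suc x) ≤⟨ bernoulli x (suc x) ⟩
  suc x ^ suc x * x       ∎)
  where
  open ≤-Reasoning
  lemma : ∀ z x → 2 * z * x ≡ z * (x + x)
  lemma = solve-∀

x^T*2^t≤[1+x]^T : ∀ x T t → suc x * t ≤ T → x ^ T * 2 ^ t ≤ suc x ^ T
x^T*2^t≤[1+x]^T x T t mt≤T = begin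
  x ^ T * 2 ^ t                  ≡⟨ cong (λ e → x ^ e * 2 ^ t) mt+r≡T ⟨
  x ^ (m * t + r) * 2 ^ t        ≡⟨ cong (_* 2 ^ t) (^-distribˡ-+-* x (m * t) r) ⟩
  x ^ (m * t) * x ^ r * 2 ^ t    ≡⟨ lemma (x ^ (m * t)) (x ^ r) (2 ^ t) ⟩
  (x ^ (m * t) * 2 ^ t) * x ^ r  ≡⟨ cong (λ e → (e * 2 ^ t) * x ^ r) (^-*-assoc x m t) ⟨
  ((x ^ m) ^ t * 2 ^ t) * x ^ r  ≡⟨ cong (_* x ^ r) (trans (*-comm ((x ^ m) ^ t) (2 ^ t)) (sym (^-distribʳ-* 2 (x ^ m) t))) ⟩
  (2 * x ^ m) ^ t * x ^ r        ≤⟨ *-mono-≤ (^-monoˡ-≤ t (2*x^[1+x]≤[1+x]^[1+x] x)) (^-monoˡ-≤ r (n≤1+n x)) ⟩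
  (m ^ m) ^ t * m ^ r            ≡⟨ cong (_* m ^ r) (^-*-assoc m m t) ⟩
  m ^ (m * t) * m ^ r            ≡⟨ ^-distribˡ-+-* m (m * t) r ⟨
  m ^ (m * t + r)                ≡⟨ cong (m ^_) mt+r≡T ⟩
  m ^ T                          ∎
  where
  open ≤-Reasoning
  m = suc x
  r = T ∸ m * t
  mt+r≡T : m * t + r ≡ T
  mt+r≡T = m+[n∸m]≡n mt≤T
  lemma : ∀ a b c → a * b * c ≡ (a * c) * b
  lemma = solve-∀

log₂-bracket : ∀ m → ∃[ a ] 2 ^ a < 2 + m × 2 + m ≤ 2 ^ suc a
log₂-bracket zero = 0 , s≤s (s≤s z≤n) , s≤s (s≤s z≤n)
log₂-bracket (suc m) with log₂-bracket m
... | a , lower , upper with 3 + m ≤? 2 ^ suc a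
...   | yes upper′ = a , m≤n⇒m≤1+n lower , upper′
...   | no  ¬upper′ = suc a , subst (_< 3 + m) 2+m≡2^[1+a] (n<1+n (2 + m)) , (begin
  3 + m                 ≡⟨ cong suc 2+m≡2^[1+a] ⟩
  suc (2 ^ suc a)       ≤⟨ +-monoˡ-≤ (2 ^ suc a) (m^n>0 2 (suc a)) ⟩
  2 ^ suc a + 2 ^ suc a ≡⟨ cong (2 ^ suc a +_) (+-identityʳ (2 ^ suc a)) ⟨
  2 ^ suc (suc a)       ∎)
  where
  open ≤-Reasoning
  2+m≡2^[1+a] : 2 + m ≡ 2 ^ suc a
  2+m≡2^[1+a] = ≤-antisym upper (≮⇒≥ ¬upper′)

a+[1+a]*a≤a³ : ∀ a → 3 ≤ a → a + suc a * a ≤ a ^ 3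
a+[1+a]*a≤a³ a 3≤a = begin
  a + suc a * a                                                       ≡⟨ cong (λ b → b + suc b * b) c+3≡a ⟨
  (c + 3) + suc (c + 3) * (c + 3)                                     ≤⟨ m≤m+n _ (c * c * c + 8 * c * c + 19 * c + 12) ⟩
  (c + 3) + suc (c + 3) * (c + 3) + (c * c * c + 8 * c * c + 19 * c + 12) ≡⟨ lemma c ⟩
  (c + 3) ^ 3                                                         ≡⟨ cong (_^ 3) c+3≡a ⟩
  a ^ 3                                                               ∎
  where
  open ≤-Reasoning
  c = a ∸ 3
  c+3≡a : c + 3 ≡ a
  c+3≡a = m∸n+n≡m 3≤a
  lemma : ∀ c → (c + 3) + suc (c + 3) * (c + 3) + (c * c * c + 8 * c * c + 19 * c + 12) ≡ (c + 3) * ((c + 3) * ((c + 3) * 1))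
  lemma = solve-∀

2^m<2^n⇒m<n : ∀ {m n} → 2 ^ m < 2 ^ n → m < n
2^m<2^n⇒m<n 2^m<2^n = ≰⇒> λ n≤m → <⇒≱ 2^m<2^n (^-monoʳ-≤ 2 n≤m)

2^m≤2^n⇒m≤n : ∀ {m n} → 2 ^ m ≤ 2 ^ n → m ≤ n
2^m≤2^n⇒m≤n 2^m≤2^n = ≮⇒≥ λ n<m → <⇒≱ (^-monoʳ-< 2 (s≤s (s≤s z≤n)) n<m) 2^m≤2^n

LogBound⇒2^k*a³≤n : ∀ {n k} a → LogBound n k → 2 ^ a < n → 2 ^ k * a ^ 3 ≤ n
LogBound⇒2^k*a³≤n {n} a logBound 2^a<n = ≤-trans
  (≮⇒≥ λ n*1<2^k*a³ → <⇒≱ 2^a<n (subst (_≤ 2 ^ a) (*-identityʳ n) (logBound a 1 (s≤s z≤n) n*1<2^k*a³)))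
  (≤-reflexive (*-identityʳ n))

2^K*t≤n∸K : ∀ n K t → 1 ≤ t → 2 ^ suc K * t ≤ n → 2 ^ K * t ≤ n ∸ K
2^K*t≤n∸K n K t 1≤t 2^[1+K]*t≤n = m+n≤o⇒m≤o∸n (2 ^ K * t) (begin
  2 ^ K * t + K         ≤⟨ +-monoʳ-≤ (2 ^ K * t) (<⇒≤ (<-≤-trans (n<2^n K) (m≤m*n (2 ^ K) t {{>-nonZero 1≤t}}))) ⟩
  2 ^ K * t + 2 ^ K * t ≡⟨ lemma (2 ^ K) t ⟩
  2 ^ suc K * t         ≤⟨ 2^[1+K]*t≤n ⟩
  n                     ∎)
  where
  open ≤-Reasoning
  lemma : ∀ m t → m * t + m * t ≡ 2 * m * t
  lemma = solve-∀

d*nCK≤2^a³ : ∀ d n K a → d + 3 ≤ a → K ≤ a → n ≤ 2 ^ suc a → d * (n C K) ≤ 2 ^ (a ^ 3)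
d*nCK≤2^a³ d n K a d+3≤a K≤a n≤2^[1+a] = begin
  d * (n C K)                 ≤⟨ *-mono-≤ (≤-trans (<⇒≤ (n<2^n d)) (^-monoʳ-≤ 2 (m+n≤o⇒m≤o d d+3≤a)))
                                          (nCk≤n^k n K) ⟩
  2 ^ a * n ^ K               ≤⟨ *-monoʳ-≤ (2 ^ a) (^-monoˡ-≤ K n≤2^[1+a]) ⟩
  2 ^ a * (2 ^ suc a) ^ K     ≡⟨ cong (2 ^ a *_) (^-*-assoc 2 (suc a) K) ⟩
  2 ^ a * 2 ^ (suc a * K)     ≤⟨ *-monoʳ-≤ (2 ^ a) (^-monoʳ-≤ 2 (*-monoʳ-≤ (suc a) K≤a)) ⟩
  2 ^ a * 2 ^ (suc a * a)     ≡⟨ ^-distribˡ-+-* 2 a (suc a * a) ⟨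
  2 ^ (a + suc a * a)         ≤⟨ ^-monoʳ-≤ 2 (a+[1+a]*a≤a³ a (m+n≤o⇒n≤o d d+3≤a)) ⟩
  2 ^ (a ^ 3)                 ∎
  where open ≤-Reasoning

-- Take a with 2 ^ a < n ≤ 2 ^ (a + 1). The hypothesis gives 2 ^ K a³ ≤ n - K, hence
-- (1 - 2 ^ -K) ^ (n - K) ≤ 2 ^ -a³, while d (n choose K) ≤ 2 ^ a³ as soon as a ≥ d + 3.
d*nCK*[2^K-1]^[n-K]≤[2^K]^[n-K] : ∀ d n K → 2 ^ (d + 3) < n → LogBound n (suc K) →
  d * (n C K) * (2 ^ K ∸ 1) ^ (n ∸ K) ≤ (2 ^ K) ^ (n ∸ K)
d*nCK*[2^K-1]^[n-K]≤[2^K]^[n-K] d n K 2^[d+3]<n logBound = begin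
  d * (n C K) * (2 ^ K ∸ 1) ^ (n ∸ K)   ≤⟨ *-monoˡ-≤ _ (d*nCK≤2^a³ d n K a d+3≤a K≤a n≤2^[1+a]) ⟩
  2 ^ t * (2 ^ K ∸ 1) ^ (n ∸ K)         ≡⟨ *-comm (2 ^ t) _ ⟩
  (2 ^ K ∸ 1) ^ (n ∸ K) * 2 ^ t         ≤⟨ x^T*2^t≤[1+x]^T (2 ^ K ∸ 1) (n ∸ K) t
                                             (subst (λ m → m * t ≤ n ∸ K) (sym 1+[2^K-1]≡2^K)
                                                    (2^K*t≤n∸K n K t 1≤t 2^[1+K]*t≤n)) ⟩
  suc (2 ^ K ∸ 1) ^ (n ∸ K)             ≡⟨ cong (_^ (n ∸ K)) 1+[2^K-1]≡2^K ⟩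
  (2 ^ K) ^ (n ∸ K)                     ∎
  where
  open ≤-Reasoning
  n≡2+[n-2] : n ≡ 2 + (n ∸ 2)
  n≡2+[n-2] = trans (sym (m∸n+n≡m (≤-trans (s≤s (m^n>0 2 (d + 3))) 2^[d+3]<n))) (+-comm (n ∸ 2) 2)
  a = proj₁ (log₂-bracket (n ∸ 2))
  2^a<n : 2 ^ a < n
  2^a<n = subst (2 ^ a <_) (sym n≡2+[n-2]) (proj₁ (proj₂ (log₂-bracket (n ∸ 2))))
  n≤2^[1+a] : n ≤ 2 ^ suc a
  n≤2^[1+a] = subst (_≤ 2 ^ suc a) (sym n≡2+[n-2]) (proj₂ (proj₂ (log₂-bracket (n ∸ 2))))
  d+3≤a : d + 3 ≤ a
  d+3≤a = ≤-pred (2^m<2^n⇒m<n (<-≤-trans 2^[d+3]<n n≤2^[1+a]))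
  1≤a : 1 ≤ a
  1≤a = ≤-trans (s≤s z≤n) (m+n≤o⇒n≤o d d+3≤a)
  t = a ^ 3
  1≤t : 1 ≤ t
  1≤t = m^n>0 a {{>-nonZero 1≤a}} 3
  2^[1+K]*t≤n : 2 ^ suc K * t ≤ n
  2^[1+K]*t≤n = LogBound⇒2^k*a³≤n {k = suc K} a logBound 2^a<n
  K≤a : K ≤ a
  K≤a = ≤-pred (2^m≤2^n⇒m≤n (≤-trans (m≤m*n (2 ^ suc K) t {{>-nonZero 1≤t}}) (≤-trans 2^[1+K]*t≤n n≤2^[1+a])))
  1+[2^K-1]≡2^K : suc (2 ^ K ∸ 1) ≡ 2 ^ K
  1+[2^K-1]≡2^K = trans (+-comm 1 _) (m∸n+n≡m (m^n>0 2 K))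

relative-error : ∀ d m R e → m ≤ R → R ≤ m + e → d * e ≤ R → d * m ≤ (d + 1) * R × (d ∸ 1) * R ≤ d * m
relative-error d m R e m≤R R≤m+e d*e≤R = ≤-trans (*-monoʳ-≤ d m≤R) (*-monoˡ-≤ R (m≤m+n d 1)) , (begin
  (d ∸ 1) * R       ≡⟨ *-distribʳ-∸ R d 1 ⟩
  d * R ∸ 1 * R     ≡⟨ cong (d * R ∸_) (*-identityˡ R) ⟩
  d * R ∸ R         ≤⟨ ∸-monoˡ-≤ R (begin
    d * R             ≤⟨ *-monoʳ-≤ d R≤m+e ⟩
    d * (m + e)       ≡⟨ *-distribˡ-+ d m e ⟩
    d * m + d * e     ≤⟨ +-monoʳ-≤ (d * m) d*e≤R ⟩
    d * m + R         ∎) ⟩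
  d * m + R ∸ R     ≡⟨ m+n∸n≡m (d * m) R ⟩
  d * m             ∎)
  where open ≤-Reasoning

proposition6p1 : (d : ℕ) → 1 ≤ d →
    ∃[ N ] ((n k : ℕ) → N ≤ n → 1 ≤ k → k ≤ n → LogBound n k →
      (d * mis n k ≤ (d + 1) * 2 ^ (n C (k ∸ 1)))
      × ((d ∸ 1) * 2 ^ (n C (k ∸ 1)) ≤ d * mis n k))
proposition6p1 d _ = suc (2 ^ (d + 3)) , λ where
  n zero    _          ()
  n (suc K) 2^[d+3]<n _ _ logBound → let open LevelGraph n K in
    relative-error d (mis n (suc K)) (2 ^ (n C K)) _ mis≤2^nCK 2^nCK≤mis+undominated
      (d*undominated≤2^nCK d (d*nCK*[2^K-1]^[n-K]≤[2^K]^[n-K] d n K 2^[d+3]<n logBound))
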